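{- Let $G$ be an $r$-regular interval colorable graph and let $n$ be a positive integer. Then $G\square Q_n$ is interval colorable and $$W(G\square Q_n)\geq W(G)+\frac{n(n+2r+1)}{2}.$$
   Context: All graphs are finite, undirected, without loops or multiple edges. An edge-coloring of a graph $G$ with colors $1,\ldots,t$ is an interval $t$-coloring if all $t$ colors are used, and the colors of the edges incident to each vertex are distinct and form an interval of consecutive integers. A graph is interval colorable if it has an interval $t$-coloring for some positive integer $t$; for such a graph, $W(G)$ is the greatest such $t$. $Q_n$ is the Cartesian product of $n$ copies of $K_2$. The Cartesian product $G\square H$ has vertex set $V(G)\times V(H)$, with $(u_1,v_1)(u_2,v_2)$ an edge iff either $u_1=u_2$ and $v_1v_2\in E(H)$, or $v_1=v_2$ and $u_1u_2\in E(G)$. -}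

module Defs where

open import Data.Nat using (ℕ; zero; suc; _+_; _*_; _≤_)
open import Data.Fin using (Fin; remQuot)
open import Data.Fin.Properties using (_≟_)
open import Data.Product using (_×_; _,_; ∃; ∃-syntax; proj₁; proj₂)
open import Data.Sum using (_⊎_; inj₁; inj₂)
open import Data.Empty using (⊥)
open import Data.List using (length; filter; allFin)
open import Relation.Nullary using (¬_; Dec; yes; no)
open import Relation.Nullary.Decidable using (_×-dec_; _⊎-dec_)
open import Relation.Binary.PropositionalEquality using (_≡_; refl; sym)

record Graph : Set₁ where
  field
    size   : ℕ
    Adj    : Fin size → Fin size → Set
    adj?   : ∀ u v → Dec (Adj u v)
    symAdj : ∀ {u v} → Adj u v → Adj v u
    irrefl : ∀ {v} → ¬ Adj v v
open Graph public

degree : (G : Graph) → Fin (size G) → ℕ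
degree G v = length (filter (adj? G v) (allFin (size G)))

Regular : Graph → ℕ → Set
Regular G r = ∀ v → degree G v ≡ r

ProdAdj : (G H : Graph) → Fin (size G) × Fin (size H) → Fin (size G) × Fin (size H) → Set
ProdAdj G H (u₁ , v₁) (u₂ , v₂) = (u₁ ≡ u₂ × Adj H v₁ v₂) ⊎ (v₁ ≡ v₂ × Adj G u₁ u₂)

prodAdj? : (G H : Graph) → ∀ p q → Dec (ProdAdj G H p q)
prodAdj? G H (u₁ , v₁) (u₂ , v₂) = ((u₁ ≟ u₂) ×-dec adj? H v₁ v₂) ⊎-dec ((v₁ ≟ v₂) ×-dec adj? G u₁ u₂)

prodSym : (G H : Graph) → ∀ {p q} → ProdAdj G H p q → ProdAdj G H q p
prodSym G H (inj₁ (e , a)) = inj₁ (sym e , symAdj H a)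
prodSym G H (inj₂ (e , a)) = inj₂ (sym e , symAdj G a)

prodIrrefl : (G H : Graph) → ∀ {p} → ¬ ProdAdj G H p p
prodIrrefl G H (inj₁ (_ , a)) = irrefl H a
prodIrrefl G H (inj₂ (_ , a)) = irrefl G a

infixl 6 _□_
_□_ : Graph → Graph → Graph
G □ H = record
  { size   = size G * size H
  ; Adj    = λ x y → ProdAdj G H (remQuot (size H) x) (remQuot (size H) y)
  ; adj?   = λ x y → prodAdj? G H (remQuot (size H) x) (remQuot (size H) y)
  ; symAdj = prodSym G H
  ; irrefl = prodIrrefl G H
  }

K1 : Graph
K1 = record { size = 1 ; Adj = λ _ _ → ⊥ ; adj? = λ _ _ → no (λ ()) ; symAdj = λ () ; irrefl = λ () }

K2 : Graph
K2 = record
  { size = 2 ; Adj = λ u v → ¬ (u ≡ v) ; adj? = λ u v → dec u v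
  ; symAdj = λ ne e → ne (sym e) ; irrefl = λ ne → ne refl }
  where
  dec : (u v : Fin 2) → Dec (¬ (u ≡ v))
  dec u v with u ≟ v
  ... | yes e = no (λ ne → ne e)
  ... | no ne = yes ne

Q : ℕ → Graph
Q zero    = K1
Q (suc n) = Q n □ K2

record IsIntervalColoring (G : Graph) (t : ℕ) (c : Fin (size G) → Fin (size G) → ℕ) : Set where
  field
    symCol   : ∀ {u v} → Adj G u v → c u v ≡ c v u
    inRange  : ∀ {u v} → Adj G u v → 1 ≤ c u v × c u v ≤ t
    allUsed  : ∀ k → 1 ≤ k → k ≤ t → ∃[ u ] ∃[ v ] (Adj G u v × c u v ≡ k)
    proper   : ∀ {v u w} → Adj G v u → Adj G v w → c v u ≡ c v w → u ≡ w
    interval : ∀ {v u w} k → Adj G v u → Adj G v w → c v u ≤ k → k ≤ c v w →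
               ∃[ x ] (Adj G v x × c v x ≡ k)

HasIntervalColoring : Graph → ℕ → Set
HasIntervalColoring G t = ∃[ c ] IsIntervalColoring G t c

IntervalColorable : Graph → Set
IntervalColorable G = ∃[ t ] (1 ≤ t × HasIntervalColoring G t)

IsW : Graph → ℕ → Set
IsW G w = HasIntervalColoring G w × (∀ t → HasIntervalColoring G t → t ≤ w)

-- In an r-regular graph every vertex v of an interval colouring sees
-- exactly r consecutive colours low v, …, low v + r − 1 (its colours are
-- distinct, gap-free and r in number).  Such a "regular colouring" of H with t
-- colours doubles to one of H □ K₂ with t + r + 1 colours and degree r + 1: keep
-- the colouring on layer 0, shift it by r + 1 on layer 1 and give the rung at v
-- the colour low v + r.  Since G □ Qₙ₊₁ ≅ (G □ Qₙ) □ K₂, doubling n times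
-- starting from a W(G)-colouring of G yields W(G) + Σ_{i<n} (r + i + 1) colours.
module Submission where

open import Defs
open import Data.Nat using (ℕ; zero; suc; _+_; _*_; _≤_; _<_; _∸_; z≤n; s≤s; _≤?_; _<?_; s≤s⁻¹)
open import Data.Nat.Properties
open import Data.Fin using (Fin; toℕ; fromℕ<; remQuot; combine)
open import Data.Fin.Patterns using (0F; 1F)
import Data.Fin.Properties as FinP
open import Data.Product using (_×_; _,_; ∃-syntax; proj₁; proj₂)
open import Data.Empty using (⊥-elim)
open import Data.Sum using (inj₁; inj₂)
open import Relation.Nullary using (yes; no)
open import Data.List using (List; []; _∷_; length; filter; allFin; lookup)
open import Data.List.Relation.Unary.All as All using (_∷_)
open import Data.List.Relation.Unary.Any using (here; there; index)
open import Data.List.Relation.Unary.Any.Properties using (lookup-index)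
open import Data.List.Relation.Unary.AllPairs using (_∷_)
open import Data.List.Membership.Propositional using (_∈_)
open import Data.List.Membership.Propositional.Properties using (∈-lookup; ∈-filter⁺; ∈-filter⁻; ∈-allFin)
open import Data.List.Relation.Unary.Unique.Propositional using (Unique)
import Data.List.Relation.Unary.Unique.Propositional.Properties as UniqueP
open import Data.List.Extrema.Nat using (argmin; argmax; argmin-all; argmax-all;
  f[argmin]≤f[⊤]; f[argmin]≤f[xs]; f[⊥]≤f[argmax]; f[xs]≤f[argmax])
open import Relation.Binary.PropositionalEquality
open import Data.Nat.Solver using (module +-*-Solver)

record ExactInterval {A : Set} (P : A → Set) (f : A → ℕ) (lo m : ℕ) : Set where
  field
    lowerBound : ∀ {x} → P x → lo ≤ f x
    upperBound : ∀ {x} → P x → f x < lo + m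
    attained   : ∀ k → lo ≤ k → k < lo + m → ∃[ x ] (P x × f x ≡ k)

lookup-injective : ∀ {A : Set} {xs : List A} → Unique xs →
                   ∀ i j → lookup xs i ≡ lookup xs j → i ≡ j
lookup-injective (_ ∷ _)     Fin.zero    Fin.zero    _ = refl
lookup-injective (x≢ ∷ _)    Fin.zero    (Fin.suc j) e = ⊥-elim (All.lookup x≢ (∈-lookup j) e)
lookup-injective (x≢ ∷ _)    (Fin.suc i) Fin.zero    e = ⊥-elim (All.lookup x≢ (∈-lookup i) (sym e))
lookup-injective (_ ∷ uniq)  (Fin.suc i) (Fin.suc j) e = cong Fin.suc (lookup-injective uniq i j e)

-- Counting by injections both ways: if `f` is injective on the duplicate-free
-- list `xs` and maps it onto the interval [lo, hi], then `xs` has hi ∸ lo + 1 entries.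
length-onto-interval : ∀ {A : Set} (f : A → ℕ) {xs : List A} {lo hi : ℕ} → Unique xs →
  (∀ {x y} → x ∈ xs → y ∈ xs → f x ≡ f y → x ≡ y) →
  (∀ {x} → x ∈ xs → lo ≤ f x × f x ≤ hi) →
  (∀ k → lo ≤ k → k ≤ hi → ∃[ x ] (x ∈ xs × f x ≡ k)) →
  lo ≤ hi → length xs ≡ suc (hi ∸ lo)
length-onto-interval f {xs} {lo} {hi} uniq inj range onto lo≤hi =
  ≤-antisym (FinP.injective⇒≤ offset-injective) (FinP.injective⇒≤ position-injective)
  where
  -- the value of the i-th entry, as an offset inside the interval
  offset : Fin (length xs) → Fin (suc (hi ∸ lo))
  offset i = fromℕ< (s≤s (∸-monoˡ-≤ lo (proj₂ (range (∈-lookup i)))))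

  offset-injective : ∀ {i j} → offset i ≡ offset j → i ≡ j
  offset-injective {i} {j} e = lookup-injective uniq i j
    (inj (∈-lookup i) (∈-lookup j) (begin
      f (lookup xs i)              ≡⟨ m∸n+n≡m (proj₁ (range (∈-lookup i))) ⟨
      f (lookup xs i) ∸ lo + lo    ≡⟨ cong (_+ lo) (FinP.fromℕ<-injective _ _ _ _ e) ⟩
      f (lookup xs j) ∸ lo + lo    ≡⟨ m∸n+n≡m (proj₁ (range (∈-lookup j))) ⟩
      f (lookup xs j)              ∎))
    where open ≡-Reasoning

  witness : (j : Fin (suc (hi ∸ lo))) → ∃[ x ] (x ∈ xs × f x ≡ lo + toℕ j)
  witness j = onto (lo + toℕ j) (m≤m+n lo (toℕ j))
    (≤-trans (+-monoʳ-≤ lo (s≤s⁻¹ (FinP.toℕ<n j))) (≤-reflexive (m+[n∸m]≡n lo≤hi)))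

  position : Fin (suc (hi ∸ lo)) → Fin (length xs)
  position j = index (proj₁ (proj₂ (witness j)))

  position-injective : ∀ {j k} → position j ≡ position k → j ≡ k
  position-injective {j} {k} e = FinP.toℕ-injective (+-cancelˡ-≡ lo _ _ (begin
      lo + toℕ j                  ≡⟨ proj₂ (proj₂ (witness j)) ⟨
      f (proj₁ (witness j))       ≡⟨ cong f (lookup-index (proj₁ (proj₂ (witness j)))) ⟩
      f (lookup xs (position j))  ≡⟨ cong (λ i → f (lookup xs i)) e ⟩
      f (lookup xs (position k))  ≡⟨ cong f (lookup-index (proj₁ (proj₂ (witness k)))) ⟨
      f (proj₁ (witness k))       ≡⟨ proj₂ (proj₂ (witness k)) ⟩
      lo + toℕ k                  ∎))
    where open ≡-Reasoning

list-exactInterval : ∀ {A : Set} (f : A → ℕ) {xs : List A} → Unique xs →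
  (∀ {x y} → x ∈ xs → y ∈ xs → f x ≡ f y → x ≡ y) →
  (∀ {x y} k → x ∈ xs → y ∈ xs → f x ≤ k → k ≤ f y → ∃[ z ] (z ∈ xs × f z ≡ k)) →
  ∃[ lo ] ExactInterval (_∈ xs) f lo (length xs)
list-exactInterval f {[]} _ _ _ =
  0 , record { lowerBound = λ () ; upperBound = λ () ; attained = λ _ _ () }
list-exactInterval {A} f {x ∷ xs} uniq inj fill = f min , record
  { lowerBound = min≤
  ; upperBound = λ {y} y∈ → subst (f y <_) (sym top) (s≤s (≤max y∈))
  ; attained   = λ k min≤k k<top → fill k min∈ max∈ min≤k (s≤s⁻¹ (subst (k <_) top k<top))
  }
  where
  min max : A
  min = argmin f x xs
  max = argmax f x xs

  min∈ : min ∈ x ∷ xs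
  min∈ = argmin-all f (here refl) (All.tabulate there)
  max∈ : max ∈ x ∷ xs
  max∈ = argmax-all f (here refl) (All.tabulate there)

  min≤ : ∀ {y} → y ∈ x ∷ xs → f min ≤ f y
  min≤ = All.lookup (f[argmin]≤f[⊤] {f = f} x xs ∷ f[argmin]≤f[xs] {f = f} x xs)
  ≤max : ∀ {y} → y ∈ x ∷ xs → f y ≤ f max
  ≤max = All.lookup (f[⊥]≤f[argmax] {f = f} x xs ∷ f[xs]≤f[argmax] {f = f} x xs)

  top : f min + length (x ∷ xs) ≡ suc (f max)
  top = begin
    f min + length (x ∷ xs)          ≡⟨ cong (f min +_) (length-onto-interval f uniq inj
                                          (λ y∈ → min≤ y∈ , ≤max y∈)
                                          (λ k l h → fill k min∈ max∈ l h) (min≤ max∈)) ⟩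
    f min + suc (f max ∸ f min)      ≡⟨ +-suc (f min) _ ⟩
    suc (f min + (f max ∸ f min))    ≡⟨ cong suc (m+[n∸m]≡n (min≤ max∈)) ⟩
    suc (f max)                      ∎
    where open ≡-Reasoning

neighbours : (G : Graph) → Fin (size G) → List (Fin (size G))
neighbours G v = filter (adj? G v) (allFin (size G))

neighbour⁺ : (G : Graph) {v u : Fin (size G)} → Adj G v u → u ∈ neighbours G v
neighbour⁺ G {v} {u} a = ∈-filter⁺ (adj? G v) (∈-allFin u) a

neighbour⁻ : (G : Graph) {v u : Fin (size G)} → u ∈ neighbours G v → Adj G v u
neighbour⁻ G {v} u∈ = proj₂ (∈-filter⁻ (adj? G v) {xs = allFin (size G)} u∈)

neighbours-unique : (G : Graph) (v : Fin (size G)) → Unique (neighbours G v)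
neighbours-unique G v = UniqueP.filter⁺ (adj? G v) (UniqueP.allFin⁺ (size G))

-- A colouring of an edge relation `E` with colours 1, …, t in which every vertex
-- sees exactly the r consecutive colours low p, …, low p + r ∸ 1.  On a graph this
-- is an interval colouring of an r-regular graph, but the notion makes sense for
-- any vertex type, which lets it be transported along isomorphisms.
record RegularColoring {P : Set} (E : P → P → Set) (t r : ℕ) (c : P → P → ℕ) : Set where
  field
    symmetric : ∀ {p q} → E p q → c p q ≡ c q p
    inRange   : ∀ {p q} → E p q → 1 ≤ c p q × c p q ≤ t
    allUsed   : ∀ k → 1 ≤ k → k ≤ t → ∃[ p ] ∃[ q ] (E p q × c p q ≡ k)
    proper    : ∀ {p q s} → E p q → E p s → c p q ≡ c p s → q ≡ s
    low       : P → ℕ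
    spectrum  : ∀ p → ExactInterval (E p) (c p) (low p) r

-- In an r-regular graph every vertex sees exactly r consecutive colours: its
-- colours are distinct and have no gaps, and there are r of them.
regularColoring : ∀ {G r t c} → Regular G r → IsIntervalColoring G t c →
                  RegularColoring (Adj G) t r c
regularColoring {G} {r} {t} {c} reg I = record
  { symmetric = symCol ; inRange = inRange ; allUsed = allUsed ; proper = proper
  ; low = λ v → proj₁ (spectrum v) ; spectrum = λ v → proj₂ (spectrum v) }
  where
  open IsIntervalColoring I

  spectrum : ∀ v → ∃[ lo ] ExactInterval (Adj G v) (c v) lo r
  spectrum v with list-exactInterval (c v) (neighbours-unique G v)
                    (λ u∈ w∈ → proper (neighbour⁻ G u∈) (neighbour⁻ G w∈))
                    (λ k u∈ w∈ l h → let x , a , e = interval k (neighbour⁻ G u∈) (neighbour⁻ G w∈) l h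
                                     in x , neighbour⁺ G a , e)
  ... | lo , N = lo , record
    { lowerBound = λ a → lowerBound (neighbour⁺ G a)
    ; upperBound = λ a → subst (λ m → _ < lo + m) (reg v) (upperBound (neighbour⁺ G a))
    ; attained   = λ k l h → let x , x∈ , e = attained k l (subst (λ m → k < lo + m) (sym (reg v)) h)
                             in x , neighbour⁻ G x∈ , e }
    where open ExactInterval N

toIntervalColoring : ∀ {G r t c} → RegularColoring (Adj G) t r c → IsIntervalColoring G t c
toIntervalColoring C = record
  { symCol = symmetric ; inRange = inRange ; allUsed = allUsed ; proper = proper
  ; interval = λ {v} k a b l h → attained (spectrum v) k (≤-trans (lowerBound (spectrum v) a) l)
                                          (≤-<-trans h (upperBound (spectrum v) b)) }
  where open RegularColoring C
        open ExactInterval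

-- Once some colour is used, every vertex sees a colour, so r ≥ 1, and the
-- colour interval of every vertex lies within [1, t].
module Bounds {P : Set} {E : P → P → Set} {t r c} (C : RegularColoring E t r c) (t≥1 : 1 ≤ t) where
  open RegularColoring C
  open ExactInterval

  degree-positive : 1 ≤ r
  degree-positive with allUsed 1 ≤-refl t≥1
  ... | p , q , e , _ = +-cancelˡ-< (low p) 0 r
        (subst (_< low p + r) (sym (+-identityʳ (low p)))
               (≤-<-trans (lowerBound (spectrum p) e) (upperBound (spectrum p) e)))

  -- the colour at offset i of the interval of p is used, hence lies in [1, t]
  colour-at : ∀ p i → i < r → 1 ≤ low p + i × low p + i ≤ t
  colour-at p i i<r with attained (spectrum p) (low p + i) (m≤m+n (low p) i) (+-monoʳ-< (low p) i<r)
  ... | q , e , eq = subst (λ k → 1 ≤ k × k ≤ t) eq (inRange e)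

  low-positive : ∀ p → 1 ≤ low p
  low-positive p = subst (1 ≤_) (+-identityʳ (low p)) (proj₁ (colour-at p 0 degree-positive))

  low≤t : ∀ p → low p ≤ t
  low≤t p = subst (_≤ t) (+-identityʳ (low p)) (proj₂ (colour-at p 0 degree-positive))

  top≤t : ∀ p → low p + r ≤ suc t
  top≤t p = subst (λ m → low p + m ≤ suc t) r-pred+1
    (≤-trans (≤-reflexive (+-suc (low p) (r ∸ 1)))
             (s≤s (proj₂ (colour-at p (r ∸ 1) (≤-reflexive r-pred+1)))))
    where
    r-pred+1 : suc (r ∸ 1) ≡ r
    r-pred+1 = m+[n∸m]≡n degree-positive

unshift : ∀ lo m s {k} → lo + s ≤ k → k < lo + m + s →
          lo ≤ k ∸ s × k ∸ s < lo + m × k ∸ s + s ≡ k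
unshift lo m s {k} l h =
  m+n≤o⇒m≤o∸n lo l ,
  subst (k ∸ s <_) (m+n∸n≡m (lo + m) s) (∸-monoˡ-< h (m+n≤o⇒n≤o lo l)) ,
  m∸n+n≡m (m+n≤o⇒n≤o lo l)

-- The doubling step: a regular colouring of H with t colours and degree r yields
-- one of H □ K₂ (on pairs) with t + r + 1 colours and degree r + 1.  Layer 0
-- keeps the colouring, layer 1 shifts it by r + 1, and the rung at u receives
-- low u + r, the colour just above u's interval in layer 0 and just below it in
-- layer 1.
module Doubling (H : Graph) {t r c} (C : RegularColoring (Adj H) t r c) (t≥1 : 1 ≤ t) where
  open RegularColoring C
  open Bounds C t≥1
  open ExactInterval

  Vertex : Set
  Vertex = Fin (size H) × Fin 2

  Edge : Vertex → Vertex → Set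
  Edge = ProdAdj H K2

  colour : Vertex → Vertex → ℕ
  colour (u , 0F) (v , 0F) = c u v
  colour (u , 1F) (v , 1F) = c u v + suc r
  colour (u , _)  (_ , _)  = low u + r

  low′ : Vertex → ℕ
  low′ (u , 0F) = low u
  low′ (u , 1F) = low u + r

  t′ : ℕ
  t′ = t + suc r

  symmetric′ : ∀ {p q} → Edge p q → colour p q ≡ colour q p
  symmetric′ {u , 0F} {_ , 0F} (inj₁ (refl , ne)) = ⊥-elim (ne refl)
  symmetric′ {u , 0F} {_ , 1F} (inj₁ (refl , _))  = refl
  symmetric′ {u , 1F} {_ , 0F} (inj₁ (refl , _))  = refl
  symmetric′ {u , 1F} {_ , 1F} (inj₁ (refl , ne)) = ⊥-elim (ne refl)
  symmetric′ {u , 0F} (inj₂ (refl , a)) = symmetric a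
  symmetric′ {u , 1F} (inj₂ (refl , a)) = cong (_+ suc r) (symmetric a)

  rung-inRange : ∀ u → 1 ≤ low u + r × low u + r ≤ t′
  rung-inRange u = ≤-trans degree-positive (m≤n+m r (low u)) , +-mono-≤ (low≤t u) (n≤1+n r)

  inRange′ : ∀ {p q} → Edge p q → 1 ≤ colour p q × colour p q ≤ t′
  inRange′ {u , 0F} {_ , 0F} (inj₁ (refl , ne)) = ⊥-elim (ne refl)
  inRange′ {u , 0F} {_ , 1F} (inj₁ (refl , _))  = rung-inRange u
  inRange′ {u , 1F} {_ , 0F} (inj₁ (refl , _))  = rung-inRange u
  inRange′ {u , 1F} {_ , 1F} (inj₁ (refl , ne)) = ⊥-elim (ne refl)
  inRange′ {u , 0F} (inj₂ (refl , a)) = proj₁ (inRange a) , ≤-trans (proj₂ (inRange a)) (m≤m+n t (suc r))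
  inRange′ {u , 1F} {v , _} (inj₂ (refl , a)) =
    ≤-trans (s≤s z≤n) (m≤n+m (suc r) (c u v)) , +-monoˡ-≤ (suc r) (proj₂ (inRange a))

  lowerBound′ : ∀ {p q} → Edge p q → low′ p ≤ colour p q
  lowerBound′ {u , 0F} {_ , 0F} (inj₁ (refl , ne)) = ⊥-elim (ne refl)
  lowerBound′ {u , 0F} {_ , 1F} (inj₁ (refl , _))  = m≤m+n (low u) r
  lowerBound′ {u , 1F} {_ , 0F} (inj₁ (refl , _))  = ≤-refl
  lowerBound′ {u , 1F} {_ , 1F} (inj₁ (refl , ne)) = ⊥-elim (ne refl)
  lowerBound′ {u , 0F} (inj₂ (refl , a)) = lowerBound (spectrum u) a
  lowerBound′ {u , 1F} {v , _} (inj₂ (refl , a)) =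
    ≤-trans (+-monoˡ-≤ r (lowerBound (spectrum u) a)) (+-monoʳ-≤ (c u v) (n≤1+n r))

  upperBound′ : ∀ {p q} → Edge p q → colour p q < low′ p + suc r
  upperBound′ {u , 0F} {_ , 0F} (inj₁ (refl , ne)) = ⊥-elim (ne refl)
  upperBound′ {u , 0F} {_ , 1F} (inj₁ (refl , _))  = ≤-reflexive (sym (+-suc (low u) r))
  upperBound′ {u , 1F} {_ , 0F} (inj₁ (refl , _))  = m<m+n (low u + r) (s≤s z≤n)
  upperBound′ {u , 1F} {_ , 1F} (inj₁ (refl , ne)) = ⊥-elim (ne refl)
  upperBound′ {u , 0F} (inj₂ (refl , a)) = ≤-trans (upperBound (spectrum u) a) (+-monoʳ-≤ (low u) (n≤1+n r))
  upperBound′ {u , 1F} (inj₂ (refl , a)) = +-monoˡ-< (suc r) (upperBound (spectrum u) a)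

  -- In layer 0 the colours below low u + r come from H and low u + r from the rung;
  -- in layer 1 low u + r comes from the rung and the colours above it from H, shifted.
  attained′ : ∀ p k → low′ p ≤ k → k < low′ p + suc r → ∃[ q ] (Edge p q × colour p q ≡ k)
  attained′ (u , 0F) k l h with k <? low u + r
  ... | yes k<top = let v , a , e = attained (spectrum u) k l k<top in (v , 0F) , inj₂ (refl , a) , e
  ... | no  k≮top = (u , 1F) , inj₁ (refl , (λ ())) ,
                    ≤-antisym (≮⇒≥ k≮top) (s≤s⁻¹ (subst (k <_) (+-suc (low u) r) h))
  attained′ (u , 1F) k l h with k ≤? low u + r
  ... | yes k≤top = (u , 0F) , inj₁ (refl , (λ ())) , ≤-antisym l k≤top
  ... | no  k≰top with unshift (low u) r (suc r)
                         (subst (_≤ k) (sym (+-suc (low u) r)) (≰⇒> k≰top)) h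
  ...   | l′ , h′ , k≡ = let v , a , e = attained (spectrum u) (k ∸ suc r) l′ h′
                         in (v , 1F) , inj₂ (refl , a) , trans (cong (_+ suc r) e) k≡

  rung-fresh₀ : ∀ {u w} → Adj H u w → low u + r ≢ c u w
  rung-fresh₀ a e = <-irrefl (sym e) (upperBound (spectrum _) a)
  rung-fresh₁ : ∀ {u w} → Adj H u w → low u + r ≢ c u w + suc r
  rung-fresh₁ {u} {w} a e = <-irrefl e
    (≤-<-trans (+-monoˡ-≤ r (lowerBound (spectrum u) a)) (+-monoʳ-< (c u w) (n<1+n r)))

  proper′ : ∀ {p q s} → Edge p q → Edge p s → colour p q ≡ colour p s → q ≡ s
  proper′ {u , 0F} {_ , 0F} (inj₁ (refl , ne)) _ _ = ⊥-elim (ne refl)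
  proper′ {u , 1F} {_ , 1F} (inj₁ (refl , ne)) _ _ = ⊥-elim (ne refl)
  proper′ {u , 0F} {s = _ , 0F} _ (inj₁ (refl , ne)) _ = ⊥-elim (ne refl)
  proper′ {u , 1F} {s = _ , 1F} _ (inj₁ (refl , ne)) _ = ⊥-elim (ne refl)
  proper′ {u , 0F} {_ , 1F} {_ , 1F} (inj₁ (refl , _)) (inj₁ (refl , _)) _ = refl
  proper′ {u , 1F} {_ , 0F} {_ , 0F} (inj₁ (refl , _)) (inj₁ (refl , _)) _ = refl
  proper′ {u , 0F} {_ , 1F} (inj₁ (refl , _)) (inj₂ (refl , b)) e = ⊥-elim (rung-fresh₀ b e)
  proper′ {u , 1F} {_ , 0F} (inj₁ (refl , _)) (inj₂ (refl , b)) e = ⊥-elim (rung-fresh₁ b e)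
  proper′ {u , 0F} {s = _ , 1F} (inj₂ (refl , a)) (inj₁ (refl , _)) e = ⊥-elim (rung-fresh₀ a (sym e))
  proper′ {u , 1F} {s = _ , 0F} (inj₂ (refl , a)) (inj₁ (refl , _)) e = ⊥-elim (rung-fresh₁ a (sym e))
  proper′ {u , 0F} (inj₂ (refl , a)) (inj₂ (refl , b)) e = cong (_, 0F) (proper a b e)
  proper′ {u , 1F} {v , _} {w , _} (inj₂ (refl , a)) (inj₂ (refl , b)) e =
    cong (_, 1F) (proper a b (+-cancelʳ-≡ (suc r) (c u v) (c u w) e))

  -- Colours up to t are used in layer 0 and colours above r + 1 in layer 1; the
  -- only remaining case is k = t + 1 = r + 1, the colour of every rung.
  allUsed′ : ∀ k → 1 ≤ k → k ≤ t′ → ∃[ p ] ∃[ q ] (Edge p q × colour p q ≡ k)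
  allUsed′ k k≥1 k≤t′ with k ≤? t
  ... | yes k≤t = let u , v , a , e = allUsed k k≥1 k≤t in (u , 0F) , (v , 0F) , inj₂ (refl , a) , e
  ... | no  k≰t with suc r <? k
  ...   | yes r+1<k = let l′ , h′ , k≡ = unshift 1 t (suc r) r+1<k (s≤s k≤t′)
                          u , v , a , e = allUsed (k ∸ suc r) l′ (s≤s⁻¹ h′)
                      in (u , 1F) , (v , 1F) , inj₂ (refl , a) , trans (cong (_+ suc r) e) k≡
  ...   | no  r+1≮k = let u , _ = allUsed 1 ≤-refl t≥1 in
                      (u , 0F) , (u , 1F) , inj₁ (refl , (λ ())) ,
                      ≤-antisym (≤-trans (top≤t u) (≰⇒> k≰t))
                                (≤-trans (≮⇒≥ r+1≮k) (+-monoˡ-≤ r (low-positive u)))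

  doubled : RegularColoring Edge t′ (suc r) colour
  doubled = record
    { symmetric = symmetric′ ; inRange = inRange′ ; allUsed = allUsed′ ; proper = proper′
    ; low = low′
    ; spectrum = λ p → record { lowerBound = lowerBound′ ; upperBound = upperBound′ ; attained = attained′ p } }

record GraphIso (K : Graph) (P : Set) (E : P → P → Set) : Set where
  field
    to       : Fin (size K) → P
    from     : P → Fin (size K)
    to-from  : ∀ p → to (from p) ≡ p
    from-to  : ∀ x → from (to x) ≡ x
    adj-to   : ∀ {x y} → Adj K x y → E (to x) (to y)
    adj-from : ∀ {x y} → E (to x) (to y) → Adj K x y

transport : ∀ {K P E t r c} (iso : GraphIso K P E) → RegularColoring E t r c →
            RegularColoring (Adj K) t r (λ x y → c (GraphIso.to iso x) (GraphIso.to iso y))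
transport {K} {P} {E} {t} {r} {c} iso C = record
  { symmetric = λ a → symmetric (adj-to a)
  ; inRange   = λ a → inRange (adj-to a)
  ; allUsed   = allUsed′
  ; proper    = λ {x} {y} {z} a b e →
                  trans (sym (from-to y)) (trans (cong from (proper (adj-to a) (adj-to b) e)) (from-to z))
  ; low       = λ x → low (to x)
  ; spectrum  = λ x → record
      { lowerBound = λ a → lowerBound (spectrum (to x)) (adj-to a)
      ; upperBound = λ a → upperBound (spectrum (to x)) (adj-to a)
      ; attained   = attained′ x } }
  where
  open RegularColoring C
  open GraphIso iso
  open ExactInterval

  pull : ∀ {p q} → E p q → Adj K (from p) (from q)
  pull {p} {q} e = adj-from (subst₂ E (sym (to-from p)) (sym (to-from q)) e)

  allUsed′ : ∀ k → 1 ≤ k → k ≤ t → ∃[ x ] ∃[ y ] (Adj K x y × c (to x) (to y) ≡ k)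
  allUsed′ k k≥1 k≤t with allUsed k k≥1 k≤t
  ... | p , q , e , eq = from p , from q , pull e , trans (cong₂ c (to-from p) (to-from q)) eq

  attained′ : ∀ x k → low (to x) ≤ k → k < low (to x) + r → ∃[ y ] (Adj K x y × c (to x) (to y) ≡ k)
  attained′ x k l h with attained (spectrum (to x)) k l h
  ... | q , e , eq = from q , subst (λ z → Adj K z (from q)) (from-to x) (pull e) ,
                     trans (cong (c (to x)) (to-from q)) eq

right-unit : (G : Graph) → GraphIso (G □ K1) (Fin (size G)) (Adj G)
right-unit G = record
  { to       = λ x → proj₁ (remQuot 1 x)
  ; from     = λ g → combine g 0F
  ; to-from  = λ g → cong proj₁ (FinP.remQuot-combine g 0F)
  ; from-to  = λ x → trans (cong (combine {size G} (proj₁ (remQuot 1 x))) (fin1 _ _))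
                           (FinP.combine-remQuot {size G} 1 x)
  ; adj-to   = λ { (inj₂ (_ , a)) → a }
  ; adj-from = λ a → inj₂ (fin1 _ _ , a) }
  where
  fin1 : (i j : Fin 1) → i ≡ j
  fin1 0F 0F = refl

-- A vertex of G □ (H □ K) is coded as combine g (combine h k),
-- one of (G □ H) □ K as (combine g h , k).
module Associativity (G H K : Graph) where
  GH = G □ H
  HK = H □ K

  adj-to-coords : ∀ g₁ h₁ k₁ g₂ h₂ k₂ →
    ProdAdj G HK (g₁ , combine h₁ k₁) (g₂ , combine h₂ k₂) →
    ProdAdj GH K (combine g₁ h₁ , k₁) (combine g₂ h₂ , k₂)
  adj-to-coords g₁ h₁ k₁ g₂ h₂ k₂ (inj₁ (refl , a))
    with subst₂ (ProdAdj H K) (FinP.remQuot-combine h₁ k₁) (FinP.remQuot-combine h₂ k₂) a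
  ... | inj₁ (refl , b) = inj₁ (refl , b)
  ... | inj₂ (refl , b) = inj₂ (refl , subst₂ (ProdAdj G H) (sym (FinP.remQuot-combine g₁ h₁))
                                         (sym (FinP.remQuot-combine g₁ h₂)) (inj₁ (refl , b)))
  adj-to-coords g₁ h₁ k₁ g₂ h₂ k₂ (inj₂ (e , a)) with FinP.combine-injective h₁ k₁ h₂ k₂ e
  ... | refl , refl = inj₂ (refl , subst₂ (ProdAdj G H) (sym (FinP.remQuot-combine g₁ h₁))
                                     (sym (FinP.remQuot-combine g₂ h₁)) (inj₂ (refl , a)))

  adj-from-coords : ∀ g₁ h₁ k₁ g₂ h₂ k₂ →
    ProdAdj GH K (combine g₁ h₁ , k₁) (combine g₂ h₂ , k₂) →
    ProdAdj G HK (g₁ , combine h₁ k₁) (g₂ , combine h₂ k₂)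
  adj-from-coords g₁ h₁ k₁ g₂ h₂ k₂ (inj₁ (e , b)) with FinP.combine-injective g₁ h₁ g₂ h₂ e
  ... | refl , refl = inj₁ (refl , subst₂ (ProdAdj H K) (sym (FinP.remQuot-combine h₁ k₁))
                                     (sym (FinP.remQuot-combine h₁ k₂)) (inj₁ (refl , b)))
  adj-from-coords g₁ h₁ k₁ g₂ h₂ k₂ (inj₂ (refl , a))
    with subst₂ (ProdAdj G H) (FinP.remQuot-combine g₁ h₁) (FinP.remQuot-combine g₂ h₂) a
  ... | inj₁ (refl , b) = inj₁ (refl , subst₂ (ProdAdj H K) (sym (FinP.remQuot-combine h₁ k₁))
                                         (sym (FinP.remQuot-combine h₂ k₁)) (inj₂ (refl , b)))
  ... | inj₂ (refl , b) = inj₂ (refl , b)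

  g-of : Fin (size (G □ HK)) → Fin (size G)
  g-of x = proj₁ (remQuot (size H * size K) x)
  hk-of : Fin (size (G □ HK)) → Fin (size HK)
  hk-of x = proj₂ (remQuot {size G} (size H * size K) x)
  h-of : Fin (size (G □ HK)) → Fin (size H)
  h-of x = proj₁ (remQuot (size K) (hk-of x))
  k-of : Fin (size (G □ HK)) → Fin (size K)
  k-of x = proj₂ (remQuot {size H} (size K) (hk-of x))

  hk-coords : ∀ x → combine (h-of x) (k-of x) ≡ hk-of x
  hk-coords x = FinP.combine-remQuot {size H} (size K) (hk-of x)

  to : Fin (size (G □ HK)) → Fin (size GH) × Fin (size K)
  to x = combine (g-of x) (h-of x) , k-of x

  from : Fin (size GH) × Fin (size K) → Fin (size (G □ HK))
  from (gh , k) = combine (proj₁ (remQuot {size G} (size H) gh))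
                          (combine (proj₂ (remQuot {size G} (size H) gh)) k)

  to-from : ∀ p → to (from p) ≡ p
  to-from (gh , k) = begin
    to (from (gh , k))
      ≡⟨ cong (λ s → combine (proj₁ s) (proj₁ (remQuot (size K) (proj₂ s))) ,
                     proj₂ (remQuot {size H} (size K) (proj₂ s)))
              (FinP.remQuot-combine g (combine h k)) ⟩
    combine g (proj₁ (remQuot (size K) (combine h k))) , proj₂ (remQuot {size H} (size K) (combine h k))
      ≡⟨ cong (λ s → combine g (proj₁ s) , proj₂ s) (FinP.remQuot-combine h k) ⟩
    combine g h , k
      ≡⟨ cong (_, k) (FinP.combine-remQuot {size G} (size H) gh) ⟩
    gh , k ∎
    where
    open ≡-Reasoning
    g = proj₁ (remQuot {size G} (size H) gh)
    h = proj₂ (remQuot {size G} (size H) gh)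

  from-to : ∀ x → from (to x) ≡ x
  from-to x = begin
    from (to x)                         ≡⟨ cong (λ s → combine (proj₁ s) (combine (proj₂ s) (k-of x)))
                                                (FinP.remQuot-combine (g-of x) (h-of x)) ⟩
    combine (g-of x) (combine (h-of x) (k-of x)) ≡⟨ cong (combine (g-of x)) (hk-coords x) ⟩
    combine (g-of x) (hk-of x)          ≡⟨ FinP.combine-remQuot {size G} (size H * size K) x ⟩
    x                                   ∎
    where open ≡-Reasoning

  iso : GraphIso (G □ HK) (Fin (size GH) × Fin (size K)) (ProdAdj GH K)
  iso = record
    { to = to ; from = from ; to-from = to-from ; from-to = from-to
    ; adj-to = λ {x} {y} a → adj-to-coords (g-of x) (h-of x) (k-of x) (g-of y) (h-of y) (k-of y)
        (subst₂ (λ u v → ProdAdj G HK (g-of x , u) (g-of y , v)) (sym (hk-coords x)) (sym (hk-coords y)) a)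
    ; adj-from = λ {x} {y} a → subst₂ (λ u v → ProdAdj G HK (g-of x , u) (g-of y , v)) (hk-coords x) (hk-coords y)
        (adj-from-coords (g-of x) (h-of x) (k-of x) (g-of y) (h-of y) (k-of y) a) }

-- The number of colours after n doublings, starting from t colours on an
-- r-regular graph: doubling G □ Q n, of degree r + n, adds r + n + 1 colours.
colours : (r t n : ℕ) → ℕ
colours r t zero    = t
colours r t (suc n) = colours r t n + suc (r + n)

t≤colours : ∀ r t n → t ≤ colours r t n
t≤colours r t zero    = ≤-refl
t≤colours r t (suc n) = ≤-trans (t≤colours r t n) (m≤m+n _ _)

colours-closed-form : ∀ r t n → 2 * colours r t n ≡ 2 * t + n * (n + 2 * r + 1)
colours-closed-form r t zero    = sym (+-identityʳ (2 * t))
colours-closed-form r t (suc n) = begin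
  2 * (colours r t n + suc (r + n))                  ≡⟨ *-distribˡ-+ 2 (colours r t n) (suc (r + n)) ⟩
  2 * colours r t n + 2 * suc (r + n)                ≡⟨ cong (_+ 2 * suc (r + n)) (colours-closed-form r t n) ⟩
  2 * t + n * (n + 2 * r + 1) + 2 * suc (r + n)      ≡⟨ step r t n ⟩
  2 * t + suc n * (suc n + 2 * r + 1)                ∎
  where
  open ≡-Reasoning
  open +-*-Solver
  step : ∀ r t n → 2 * t + n * (n + 2 * r + 1) + 2 * suc (r + n) ≡ 2 * t + suc n * (suc n + 2 * r + 1)
  step = solve 3 (λ r t n → con 2 :* t :+ n :* (n :+ con 2 :* r :+ con 1) :+ con 2 :* (con 1 :+ (r :+ n))
                         := con 2 :* t :+ (con 1 :+ n) :* ((con 1 :+ n) :+ con 2 :* r :+ con 1)) refl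

-- the degree index is only determined up to propositional equality (r + 0, r + suc n)
degree-cong : ∀ {P : Set} {E : P → P → Set} {t r r′ c} → r ≡ r′ →
              RegularColoring E t r c → RegularColoring E t r′ c
degree-cong refl C = C

hypercube-coloring : ∀ {G r t} → Regular G r → HasIntervalColoring G t → 1 ≤ t → ∀ n →
                     ∃[ c ] RegularColoring (Adj (G □ Q n)) (colours r t n) (r + n) c
hypercube-coloring {G} {r} {t} reg (_ , I) t≥1 zero =
  _ , degree-cong (sym (+-identityʳ r)) (transport (right-unit G) (regularColoring reg I))
hypercube-coloring {G} {r} {t} reg h t≥1 (suc n) with hypercube-coloring reg h t≥1 n
... | _ , C = _ , degree-cong (sym (+-suc r n))
                        (transport (Associativity.iso G (Q n) K2)
                                   (Doubling.doubled (G □ Q n) C (≤-trans t≥1 (t≤colours r t n))))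

corollary1 : (G : Graph) (r n : ℕ) → Regular G r → IntervalColorable G → 1 ≤ n →
    IntervalColorable (G □ Q n) ×
    (∀ w w′ → IsW G w → IsW (G □ Q n) w′ → 2 * w + n * (n + 2 * r + 1) ≤ 2 * w′)
corollary1 G r n reg (t , t≥1 , ht) _ = colorable , bound
  where
  extend : ∀ {s} → HasIntervalColoring G s → 1 ≤ s → HasIntervalColoring (G □ Q n) (colours r s n)
  extend h s≥1 = let c , C = hypercube-coloring reg h s≥1 n in c , toIntervalColoring C

  colorable : IntervalColorable (G □ Q n)
  colorable = colours r t n , ≤-trans t≥1 (t≤colours r t n) , extend ht t≥1

  bound : ∀ w w′ → IsW G w → IsW (G □ Q n) w′ → 2 * w + n * (n + 2 * r + 1) ≤ 2 * w′
  bound w w′ (hw , maximalG) (_ , maximalGQ) = begin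
    2 * w + n * (n + 2 * r + 1)  ≡⟨ colours-closed-form r w n ⟨
    2 * colours r w n            ≤⟨ *-monoʳ-≤ 2 (maximalGQ _ (extend hw (≤-trans t≥1 (maximalG t ht)))) ⟩
    2 * w′                       ∎
    where open ≤-Reasoning
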